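{- Let $R$ be an $\omega$-algebraic lattice and let $D,C$ be the inverse-limit solutions of $D=[C\to R]$, $C=D\times C$ described below. Identify $C$ with the componentwise-ordered infinite product $D\times D\times\cdots$. Then $$\mathcal K(C)=\{\langle d_1,d_2,\dots\rangle\in\textstyle\prod_n\mathcal K(D)\mid \exists i\ \forall j\ge i\ \ d_j=\bot\}.$$
   Context: Order-theoretic notions. - An $\omega$-algebraic lattice is a complete lattice whose compact elements (elements $e$ such that $e\sqsubseteq\bigsqcup Z$ with $Z$ directed implies $e\sqsubseteq z$ for some $z\in Z$) form a countable set $\mathcal K(X)$, with every element the directed join of the compact elements below it. - $[X\to Y]$ denotes the lattice of Scott-continuous functions, ordered pointwise; products are ordered componentwise. The domains $D$ and $C$. - Put $C_0=\{\bot\}$, $D_n=[C_n\to R]$ and $C_{n+1}=D_n\times C_n$. - With the standard embedding-projection pairs (Streicher–Reus), $(D_n)$ and $(C_n)$ are projective sequences. - $D=\varprojlim D_n$ and $C=\varprojlim C_n$ are their inverse limits; they satisfy $D\cong[C\to R]$ and $C\cong D\times C$. -}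

module Defs where

open import Level using (Level; Lift; lift; _⊔_) renaming (suc to lsuc; zero to lzero)
open import Data.Nat using (ℕ; zero; suc; _≤_)
open import Data.Product using (Σ; _×_; _,_; proj₁; proj₂)
open import Data.Unit using (⊤; tt)
open import Data.Empty using (⊥; ⊥-elim)
open import Function using (_∘_)

-- Generic order-theoretic notions on a preorder (A , _⊑_).
-- "Subsets" are represented as families  f : I → A  indexed by a type I.

module _ {A : Set₁} (_⊑_ : A → A → Set₁) where

  _≈_ : A → A → Set₁
  x ≈ y = (x ⊑ y) × (y ⊑ x)

  Directed : {ℓ : Level} {I : Set ℓ} → (I → A) → Set (ℓ ⊔ lsuc lzero)
  Directed {I = I} f = I × (∀ i j → Σ I λ k → (f i ⊑ f k) × (f j ⊑ f k))

  IsLub : {ℓ : Level} {I : Set ℓ} → (I → A) → A → Set (ℓ ⊔ lsuc lzero)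
  IsLub {I = I} f s = (∀ i → f i ⊑ s) × (∀ y → (∀ i → f i ⊑ y) → s ⊑ y)

  Compact : A → Set₁
  Compact e = ∀ {I : Set} (f : I → A) → Directed f → ∀ s → IsLub f s → e ⊑ s
              → Σ I λ i → e ⊑ f i

  IsBottom : A → Set₁
  IsBottom d = ∀ x → d ⊑ x

record Lattice : Set₂ where
  field
    Carrier : Set₁
    _⊑_     : Carrier → Carrier → Set₁
    ⊑-refl  : ∀ {x} → x ⊑ x
    ⊑-trans : ∀ {x y z} → x ⊑ y → y ⊑ z → x ⊑ z
    ⋁       : {I : Set} → (I → Carrier) → Carrier
    ⋁-ub    : ∀ {I : Set} (f : I → Carrier) (i : I) → f i ⊑ ⋁ f
    ⋁-least : ∀ {I : Set} (f : I → Carrier) {y} → (∀ i → f i ⊑ y) → ⋁ f ⊑ y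

open Lattice

OmegaAlgebraic : Lattice → Set₁
OmegaAlgebraic L =
  Σ (ℕ → Carrier L) λ k →
      (∀ n → Compact (_⊑_ L) (k n))
    × (∀ e → Compact (_⊑_ L) e → Σ ℕ λ n → _≈_ (_⊑_ L) e (k n))
    × (∀ x → Directed (_⊑_ L) {I = Σ ℕ λ n → _⊑_ L (k n) x} (k ∘ proj₁)
           × IsLub (_⊑_ L) {I = Σ ℕ λ n → _⊑_ L (k n) x} (k ∘ proj₁) x)

record ContMap (X Y : Lattice) : Set₁ where
  field
    fun  : Carrier X → Carrier Y
    mono : ∀ {x y} → _⊑_ X x y → _⊑_ Y (fun x) (fun y)
    cont : ∀ {I : Set} (f : I → Carrier X) → Directed (_⊑_ X) f
           → _⊑_ Y (fun (⋁ X f)) (⋁ Y (λ i → fun (f i)))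

open ContMap

UnitL : Lattice
UnitL = record
  { Carrier = Lift _ ⊤ ; _⊑_ = λ _ _ → Lift _ ⊤
  ; ⊑-refl = lift tt ; ⊑-trans = λ _ _ → lift tt
  ; ⋁ = λ _ → lift tt ; ⋁-ub = λ _ _ → lift tt ; ⋁-least = λ _ _ → lift tt }

ProdL : Lattice → Lattice → Lattice
ProdL A B = record
  { Carrier = Carrier A × Carrier B
  ; _⊑_ = λ p q → _⊑_ A (proj₁ p) (proj₁ q) × _⊑_ B (proj₂ p) (proj₂ q)
  ; ⊑-refl = ⊑-refl A , ⊑-refl B
  ; ⊑-trans = λ p q → ⊑-trans A (proj₁ p) (proj₁ q) , ⊑-trans B (proj₂ p) (proj₂ q)
  ; ⋁ = λ f → ⋁ A (proj₁ ∘ f) , ⋁ B (proj₂ ∘ f)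
  ; ⋁-ub = λ f i → ⋁-ub A (proj₁ ∘ f) i , ⋁-ub B (proj₂ ∘ f) i
  ; ⋁-least = λ f h → ⋁-least A (proj₁ ∘ f) (proj₁ ∘ h) , ⋁-least B (proj₂ ∘ f) (proj₂ ∘ h) }

FunL : Lattice → Lattice → Lattice
FunL X R = record
  { Carrier = ContMap X R
  ; _⊑_ = λ f g → ∀ x → _⊑_ R (fun f x) (fun g x)
  ; ⊑-refl = λ _ → ⊑-refl R
  ; ⊑-trans = λ p q x → ⊑-trans R (p x) (q x)
  ; ⋁ = join
  ; ⋁-ub = λ F i x → ⋁-ub R (λ j → fun (F j) x) i
  ; ⋁-least = λ F h x → ⋁-least R (λ j → fun (F j) x) (λ i → h i x) }
  where
  join : {I : Set} → (I → ContMap X R) → ContMap X R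
  join {I} F = record
    { fun = λ x → ⋁ R (λ i → fun (F i) x)
    ; mono = λ {x} {y} x⊑y → ⋁-least R _ (λ i → ⊑-trans R (mono (F i) x⊑y) (⋁-ub R (λ j → fun (F j) y) i))
    ; cont = λ g d → ⋁-least R _ (λ i →
        ⊑-trans R (cont (F i) g d)
          (⋁-least R _ (λ j → ⊑-trans R (⋁-ub R (λ i' → fun (F i') (g j)) i)
                                      (⋁-ub R (λ j' → ⋁ R (λ i' → fun (F i') (g j'))) j)))) }

dir-image : ∀ {X Y} (h : ContMap X Y) {I : Set} {f : I → Carrier X}
          → Directed (_⊑_ X) f → Directed (_⊑_ Y) (fun h ∘ f)
dir-image h (i₀ , up) = i₀ , λ i j → let (k , a , b) = up i j in k , mono h a , mono h b

compM : ∀ {X Y Z} → ContMap Y Z → ContMap X Y → ContMap X Z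
compM {Z = Z} h g = record
  { fun = fun h ∘ fun g
  ; mono = mono h ∘ mono g
  ; cont = λ f d → ⊑-trans Z (mono h (cont g f d)) (cont h (fun g ∘ f) (dir-image g d)) }

constM : ∀ {X Y} → Carrier Y → ContMap X Y
constM {Y = Y} c = record
  { fun = λ _ → c ; mono = λ _ → ⊑-refl Y ; cont = λ f d → ⋁-ub Y (λ _ → c) (proj₁ d) }

precompM : ∀ {X Y R} → ContMap X Y → ContMap (FunL Y R) (FunL X R)
precompM {R = R} h = record
  { fun = λ f → compM f h
  ; mono = λ p x → p (fun h x)
  ; cont = λ F d x → ⊑-refl R }

prodM : ∀ {A A' B B'} → ContMap A A' → ContMap B B' → ContMap (ProdL A B) (ProdL A' B')
prodM f g = record
  { fun = λ p → fun f (proj₁ p) , fun g (proj₂ p)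
  ; mono = λ p → mono f (proj₁ p) , mono g (proj₂ p)
  ; cont = λ F d →
      cont f (proj₁ ∘ F) (proj₁ d , λ i j → let (k , a , b) = proj₂ d i j in k , proj₁ a , proj₁ b)
    , cont g (proj₂ ∘ F) (proj₁ d , λ i j → let (k , a , b) = proj₂ d i j in k , proj₂ a , proj₂ b) }

record Thread (L : ℕ → Lattice) (p : ∀ n → ContMap (L (suc n)) (L n)) : Set₁ where
  field
    elt : ∀ n → Carrier (L n)
    coh : ∀ n → _≈_ (_⊑_ (L n)) (fun (p n) (elt (suc n))) (elt n)

open Thread

_⊑lim_ : ∀ {L p} → Thread L p → Thread L p → Set₁
_⊑lim_ {L} x y = ∀ n → _⊑_ (L n) (elt x n) (elt y n)

module Tower (R : Lattice) where

  C : ℕ → Lattice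
  C zero    = UnitL
  C (suc n) = ProdL (FunL (C n) R) (C n)

  D : ℕ → Lattice
  D n = FunL (C n) R

  ⊥D₀ : Carrier (D 0)
  ⊥D₀ = ⋁ (D 0) {I = ⊥} ⊥-elim

  mutual
    eC : ∀ n → ContMap (C n) (C (suc n))
    eC zero    = constM (⊥D₀ , lift tt)
    eC (suc n) = prodM (eD n) (eC n)

    pC : ∀ n → ContMap (C (suc n)) (C n)
    pC zero    = constM (lift tt)
    pC (suc n) = prodM (pD n) (pC n)

    eD : ∀ n → ContMap (D n) (D (suc n))
    eD n = precompM (pC n)

    pD : ∀ n → ContMap (D (suc n)) (D n)
    pD n = precompM (eC n)

  Dinf : Set₁
  Dinf = Thread D pD

  Cinf : Set₁
  Cinf = Thread C pC

  _⊑D_ : Dinf → Dinf → Set₁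
  _⊑D_ = _⊑lim_

  _⊑C_ : Cinf → Cinf → Set₁
  _⊑C_ = _⊑lim_

  head : Cinf → Dinf
  elt (head c) n = proj₁ (elt c (suc n))
  coh (head c) n = proj₁ (proj₁ (coh c (suc n))) , proj₁ (proj₂ (coh c (suc n)))

  tail : Cinf → Cinf
  elt (tail c) n = proj₂ (elt c (suc n))
  coh (tail c) n = proj₂ (proj₁ (coh c (suc n))) , proj₂ (proj₂ (coh c (suc n)))

  tailⁿ : ℕ → Cinf → Cinf
  tailⁿ zero    c = c
  tailⁿ (suc i) c = tail (tailⁿ i c)

  -- identification C ≅ D × D × ⋯ :  c ↦ ⟨ d₀ , d₁ , … ⟩ with dᵢ = head (tailⁱ c)
  seq : Cinf → ℕ → Dinf
  seq c i = head (tailⁿ i c)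

-- C ≅ D × C as preorders, and a pair is compact iff both components are. Iterating, every
-- component of a compact c is compact; moreover c is the directed join of its truncations
-- ⟨d₀, …, dₙ₋₁, ⊥, ⊥, …⟩, so compactness puts c below one of them, which forces dⱼ = ⊥ for
-- j ≥ n. Conversely, induct on the index from which all dⱼ are ⊥: the all-⊥ sequence is the
-- bottom of C, hence compact, and prepending a compact component preserves compactness.
module Submission where

open import Defs
open import Data.Nat using (ℕ; zero; suc; _≤_; z≤n; s≤s; _⊔_)
open import Data.Nat.Properties using (m≤m⊔n; m≤n⊔m)
open import Data.Product using (Σ; _×_; _,_; proj₁; proj₂)
open import Data.Product.Relation.Binary.Pointwise.NonDependent using (Pointwise; ×-isPreorder)
open import Data.Empty using (⊥-elim)
open import Level using (Level; lift)
open import Function using (_∘_)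
open import Function.Bundles using (_⇔_; mk⇔; Equivalence)
open import Function.Construct.Composition using (_⇔-∘_)
open import Relation.Binary.Core using (_Preserves_⟶_)
open import Relation.Binary.Structures using (IsPreorder)
open import Relation.Binary.PropositionalEquality using (_≡_; refl; cong; sym; subst; subst₂; isEquivalence)

module _ {A : Set₁} {_⊑_ : A → A → Set₁} where

  IsBottom⇒Compact : ∀ {e} → IsBottom _⊑_ e → Compact _⊑_ e
  IsBottom⇒Compact e-bot f (i₀ , _) _ _ _ = i₀ , e-bot (f i₀)

module _ {A B : Set₁} (_⊑_ : A → A → Set₁) (_≼_ : B → B → Set₁) where

  Directed-map : (h : A → B) → h Preserves _⊑_ ⟶ _≼_
               → {I : Set} {f : I → A} → Directed _⊑_ f → Directed _≼_ (h ∘ f)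
  Directed-map h h-mono (i₀ , up) = i₀ , λ i j →
    let (k , i⊑k , j⊑k) = up i j in k , h-mono i⊑k , h-mono j⊑k

  module _ {I : Set} {f : I → A × B} {s : A × B} (lub : IsLub (Pointwise _⊑_ _≼_) f s) where

    IsLub-proj₁ : IsLub _⊑_ (proj₁ ∘ f) (proj₁ s)
    IsLub-proj₁ = proj₁ ∘ proj₁ lub
                , λ y ub → proj₁ (proj₂ lub (y , proj₂ s) (λ i → ub i , proj₂ (proj₁ lub i)))

    IsLub-proj₂ : IsLub _≼_ (proj₂ ∘ f) (proj₂ s)
    IsLub-proj₂ = proj₂ ∘ proj₁ lub
                , λ y ub → proj₂ (proj₂ lub (proj₁ s , y) (λ i → proj₁ (proj₁ lub i) , ub i))

module _ {ℓ₁ ℓ₂ : Level} {A B : Set₁} {_∼₁_ : A → A → Set ℓ₁} {_∼₂_ : B → B → Set ℓ₂}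
         {_⊑_ : A → A → Set₁} {_≼_ : B → B → Set₁}
         (⊑-isPreorder : IsPreorder _∼₁_ _⊑_) (≼-isPreorder : IsPreorder _∼₂_ _≼_) where

  open IsPreorder ⊑-isPreorder using () renaming (refl to ⊑-refl; trans to ⊑-trans)
  open IsPreorder ≼-isPreorder using () renaming (refl to ≼-refl; trans to ≼-trans)

  private
    _⊑×_ : A × B → A × B → Set₁
    _⊑×_ = Pointwise _⊑_ _≼_

  Compact-pair : ∀ {a b} → Compact _⊑_ a → Compact _≼_ b → Compact _⊑×_ (a , b)
  Compact-pair a-cpt b-cpt f f-dir s lub (a⊑s , b≼s) =
    let (i , a⊑fi) = a-cpt (proj₁ ∘ f) (Directed-map _⊑×_ _⊑_ proj₁ proj₁ f-dir) (proj₁ s)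
                           (IsLub-proj₁ _⊑_ _≼_ lub) a⊑s
        (j , b≼fj) = b-cpt (proj₂ ∘ f) (Directed-map _⊑×_ _≼_ proj₂ proj₂ f-dir) (proj₂ s)
                           (IsLub-proj₂ _⊑_ _≼_ lub) b≼s
        (k , fi⊑fk , fj⊑fk) = proj₂ f-dir i j
    in k , ⊑-trans a⊑fi (proj₁ fi⊑fk) , ≼-trans b≼fj (proj₂ fj⊑fk)

  Compact-pair-proj₁ : ∀ {a b} → Compact _⊑×_ (a , b) → Compact _⊑_ a
  Compact-pair-proj₁ {b = b} ab-cpt f (i₀ , up) s (ub , least) a⊑s =
    let (k , ab⊑fkb) = ab-cpt (λ i → f i , b) f×b-dir (s , b) f×b-lub (a⊑s , ≼-refl)
    in k , proj₁ ab⊑fkb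
    where
    f×b-dir : Directed _⊑×_ (λ i → f i , b)
    f×b-dir = i₀ , λ i j → let (k , i⊑k , j⊑k) = up i j in k , (i⊑k , ≼-refl) , (j⊑k , ≼-refl)
    f×b-lub : IsLub _⊑×_ (λ i → f i , b) (s , b)
    f×b-lub = (λ i → ub i , ≼-refl) , λ y ub′ → least (proj₁ y) (proj₁ ∘ ub′) , proj₂ (ub′ i₀)

  Compact-pair-proj₂ : ∀ {a b} → Compact _⊑×_ (a , b) → Compact _≼_ b
  Compact-pair-proj₂ {a = a} ab-cpt f (i₀ , up) s (ub , least) b≼s =
    let (k , ab⊑afk) = ab-cpt (λ i → a , f i) a×f-dir (a , s) a×f-lub (⊑-refl , b≼s)
    in k , proj₂ ab⊑afk
    where
    a×f-dir : Directed _⊑×_ (λ i → a , f i)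
    a×f-dir = i₀ , λ i j → let (k , i≼k , j≼k) = up i j in k , (⊑-refl , i≼k) , (⊑-refl , j≼k)
    a×f-lub : IsLub _⊑×_ (λ i → a , f i) (a , s)
    a×f-lub = (λ i → ⊑-refl , ub i) , λ y ub′ → proj₁ (ub′ i₀) , least (proj₂ y) (proj₂ ∘ ub′)

  Compact-pair⇔ : ∀ {a b} → Compact _⊑×_ (a , b) ⇔ (Compact _⊑_ a × Compact _≼_ b)
  Compact-pair⇔ {a} {b} = mk⇔ split-compact (λ (a-cpt , b-cpt) → Compact-pair a-cpt b-cpt)
    where
    split-compact : Compact _⊑×_ (a , b) → Compact _⊑_ a × Compact _≼_ b
    split-compact ab-cpt = Compact-pair-proj₁ ab-cpt , Compact-pair-proj₂ ab-cpt

record OrderIsomorphism {A B : Set₁} (_⊑_ : A → A → Set₁) (_≼_ : B → B → Set₁) : Set₁ where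
  field
    to         : A → B
    from       : B → A
    to-mono    : to Preserves _⊑_ ⟶ _≼_
    to-reflect : ∀ {x y} → to x ≼ to y → x ⊑ y
    to∘from    : ∀ b → _≈_ _≼_ (to (from b)) b

module _ {ℓ : Level} {A B : Set₁} {_⊑_ : A → A → Set₁} {_∼_ : B → B → Set ℓ} {_≼_ : B → B → Set₁}
         (≼-isPreorder : IsPreorder _∼_ _≼_) (iso : OrderIsomorphism _⊑_ _≼_) where

  open OrderIsomorphism iso
  open IsPreorder ≼-isPreorder using () renaming (trans to ≼-trans)

  from-mono : from Preserves _≼_ ⟶ _⊑_
  from-mono {b} {b′} b≼b′ = to-reflect (≼-trans (proj₁ (to∘from b)) (≼-trans b≼b′ (proj₂ (to∘from b′))))

  Compact-to : ∀ {a} → Compact _⊑_ a → Compact _≼_ (to a)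
  Compact-to a-cpt g g-dir s (ub , least) a≼s =
    let (k , a⊑g′k) = a-cpt (from ∘ g) (Directed-map _≼_ _⊑_ from from-mono g-dir) (from s) g′-lub
                            (to-reflect (≼-trans a≼s (proj₂ (to∘from s))))
    in k , ≼-trans (to-mono a⊑g′k) (proj₁ (to∘from (g k)))
    where
    g′-lub : IsLub _⊑_ (from ∘ g) (from s)
    g′-lub = from-mono ∘ ub , λ y g′⊑y → to-reflect (≼-trans (proj₁ (to∘from s))
               (least (to y) (λ i → ≼-trans (proj₂ (to∘from (g i))) (to-mono (g′⊑y i)))))

  Compact-to⁻¹ : ∀ {a} → Compact _≼_ (to a) → Compact _⊑_ a
  Compact-to⁻¹ a-cpt f f-dir s (ub , least) a⊑s =
    let (k , a≼fk) = a-cpt (to ∘ f) (Directed-map _⊑_ _≼_ to to-mono f-dir) (to s) f′-lub (to-mono a⊑s)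
    in k , to-reflect a≼fk
    where
    f′-lub : IsLub _≼_ (to ∘ f) (to s)
    f′-lub = to-mono ∘ ub , λ y f′≼y → ≼-trans (to-mono (least (from y)
               (λ i → to-reflect (≼-trans (f′≼y i) (proj₂ (to∘from y)))))) (proj₁ (to∘from y))

  Compact-to⇔ : ∀ {a} → Compact _⊑_ a ⇔ Compact _≼_ (to a)
  Compact-to⇔ = mk⇔ Compact-to Compact-to⁻¹

open Lattice
open Thread

⊑lim-isPreorder : ∀ {L p} → IsPreorder _≡_ (_⊑lim_ {L} {p})
⊑lim-isPreorder {L} = record
  { isEquivalence = isEquivalence
  ; reflexive     = λ { {x} refl n → ⊑-refl (L n) {elt x n} }
  ; trans         = λ {x} {y} {z} x⊑y y⊑z n → ⊑-trans (L n) {elt x n} {elt y n} {elt z n} (x⊑y n) (y⊑z n)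
  }

module TowerProperties (R : Lattice) where
  open Tower R

  ⊑D-isPreorder : IsPreorder _≡_ _⊑D_
  ⊑D-isPreorder = ⊑lim-isPreorder

  ⊑C-isPreorder : IsPreorder _≡_ _⊑C_
  ⊑C-isPreorder = ⊑lim-isPreorder

  open IsPreorder ⊑D-isPreorder using () renaming (refl to ⊑D-refl; trans to ⊑D-trans)
  open IsPreorder ⊑C-isPreorder using () renaming (refl to ⊑C-refl)

  cons : Dinf → Cinf → Cinf
  elt (cons d c) zero    = lift _
  elt (cons d c) (suc n) = elt d n , elt c n
  coh (cons d c) zero    = lift _ , lift _
  coh (cons d c) (suc n) = (proj₁ (coh d n) , proj₁ (coh c n)) , (proj₂ (coh d n) , proj₂ (coh c n))

  -- Thread-level relations unfold to non-injective functions, so their endpoints are passed explicitly.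
  ⊑C-head : ∀ x y → x ⊑C y → head x ⊑D head y
  ⊑C-head _ _ x⊑y n = proj₁ (x⊑y (suc n))

  ⊑C-tail : ∀ x y → x ⊑C y → tail x ⊑C tail y
  ⊑C-tail _ _ x⊑y n = proj₂ (x⊑y (suc n))

  ⊑C-intro : ∀ x y → head x ⊑D head y → tail x ⊑C tail y → x ⊑C y
  ⊑C-intro _ _ _     _     zero    = lift _
  ⊑C-intro _ _ hx⊑hy tx⊑ty (suc n) = hx⊑hy n , tx⊑ty n

  C≃D×C : OrderIsomorphism _⊑C_ (Pointwise _⊑D_ _⊑C_)
  C≃D×C = record
    { to         = λ c → head c , tail c
    ; from       = λ (d , c) → cons d c
    ; to-mono    = λ {x} {y} x⊑y → ⊑C-head x y x⊑y , ⊑C-tail x y x⊑y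
    ; to-reflect = λ {x} {y} (hx⊑hy , tx⊑ty) → ⊑C-intro x y hx⊑hy tx⊑ty
    ; to∘from    = λ (d , c) → (⊑D-refl {d} , ⊑C-refl {c}) , (⊑D-refl {d} , ⊑C-refl {c})
    }

  Compact-C⇔ : ∀ c → Compact _⊑C_ c ⇔ (Compact _⊑D_ (head c) × Compact _⊑C_ (tail c))
  Compact-C⇔ c = Compact-pair⇔ ⊑D-isPreorder ⊑C-isPreorder {head c} {tail c}
             ⇔-∘ Compact-to⇔ (×-isPreorder ⊑D-isPreorder ⊑C-isPreorder) C≃D×C {c}

  IsBottom-head : ∀ c → IsBottom _⊑C_ c → IsBottom _⊑D_ (head c)
  IsBottom-head c c-bot d = ⊑C-head c (cons d (tail c)) (c-bot (cons d (tail c)))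

  IsBottom-tail : ∀ c → IsBottom _⊑C_ c → IsBottom _⊑C_ (tail c)
  IsBottom-tail c c-bot y = ⊑C-tail c (cons (head c) y) (c-bot (cons (head c) y))

  IsBottom-tailⁿ : ∀ j c → IsBottom _⊑C_ c → IsBottom _⊑C_ (tailⁿ j c)
  IsBottom-tailⁿ zero    c c-bot = c-bot
  IsBottom-tailⁿ (suc j) c c-bot = IsBottom-tail (tailⁿ j c) (IsBottom-tailⁿ j c c-bot)

  tailⁿ-suc : ∀ j c → tailⁿ (suc j) c ≡ tailⁿ j (tail c)
  tailⁿ-suc zero    c = refl
  tailⁿ-suc (suc j) c = cong tail (tailⁿ-suc j c)

  seq-suc : ∀ j c → seq c (suc j) ≡ seq (tail c) j
  seq-suc j c = cong head (tailⁿ-suc j c)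

  tailⁿ-mono : ∀ j x y → x ⊑C y → tailⁿ j x ⊑C tailⁿ j y
  tailⁿ-mono zero    x y x⊑y = x⊑y
  tailⁿ-mono (suc j) x y x⊑y = ⊑C-tail (tailⁿ j x) (tailⁿ j y) (tailⁿ-mono j x y x⊑y)

  seq-mono : ∀ j x y → x ⊑C y → seq x j ⊑D seq y j
  seq-mono j x y x⊑y = ⊑C-head (tailⁿ j x) (tailⁿ j y) (tailⁿ-mono j x y x⊑y)

  ⊑C-from-seq : ∀ x y → (∀ j → seq x j ⊑D seq y j) → x ⊑C y
  ⊑C-from-seq x y x⊑y zero    = lift _
  ⊑C-from-seq x y x⊑y (suc n) = x⊑y 0 n ,
    ⊑C-from-seq (tail x) (tail y) (λ j → subst₂ _⊑D_ (seq-suc j x) (seq-suc j y) (x⊑y (suc j))) n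

  Compact-tailⁿ : ∀ j c → Compact _⊑C_ c → Compact _⊑C_ (tailⁿ j c)
  Compact-tailⁿ zero    c c-cpt = c-cpt
  Compact-tailⁿ (suc j) c c-cpt = proj₂ (Equivalence.to (Compact-C⇔ (tailⁿ j c)) (Compact-tailⁿ j c c-cpt))

  Compact-seq : ∀ c → Compact _⊑C_ c → ∀ j → Compact _⊑D_ (seq c j)
  Compact-seq c c-cpt j = proj₁ (Equivalence.to (Compact-C⇔ (tailⁿ j c)) (Compact-tailⁿ j c c-cpt))

  ⊥C : Cinf
  elt ⊥C zero    = lift _
  elt ⊥C (suc n) = ⋁ (D n) ⊥-elim , elt ⊥C n
  coh ⊥C zero    = lift _ , lift _
  coh ⊥C (suc n) = ((λ _ → ⋁-least R _ (λ ())) , proj₁ (coh ⊥C n))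
                 , ((λ _ → ⋁-least R _ (λ ())) , proj₂ (coh ⊥C n))

  ⊥C-least : IsBottom _⊑C_ ⊥C
  ⊥C-least y zero    = lift _
  ⊥C-least y (suc n) = (λ _ → ⋁-least R _ (λ ())) , ⊥C-least (tail y) n

  truncate : ℕ → Cinf → Cinf
  truncate zero    c = ⊥C
  truncate (suc n) c = cons (head c) (truncate n (tail c))

  truncate-mono : ∀ {m n} c → m ≤ n → truncate m c ⊑C truncate n c
  truncate-mono {n = n} c z≤n = ⊥C-least (truncate n c)
  truncate-mono {suc m} {suc n} c (s≤s m≤n) =
    ⊑C-intro (truncate (suc m) c) (truncate (suc n) c) (⊑D-refl {head c}) (truncate-mono (tail c) m≤n)

  truncate-≤ : ∀ n c → truncate n c ⊑C c
  truncate-≤ zero    c = ⊥C-least c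
  truncate-≤ (suc n) c = ⊑C-intro (truncate (suc n) c) c (⊑D-refl {head c}) (truncate-≤ n (tail c))

  ≤-truncate-at : ∀ n c → _⊑_ (C n) (elt c n) (elt (truncate n c) n)
  ≤-truncate-at zero    c = lift _
  ≤-truncate-at (suc n) c = ⊑-refl (D n) {elt (head c) n} , ≤-truncate-at n (tail c)

  truncate-directed : ∀ c → Directed _⊑C_ (λ n → truncate n c)
  truncate-directed c = 0 , λ m n →
    m ⊔ n , truncate-mono c (m≤m⊔n m n) , truncate-mono c (m≤n⊔m m n)

  truncate-lub : ∀ c → IsLub _⊑C_ (λ n → truncate n c) c
  truncate-lub c = (λ n → truncate-≤ n c)
                 , λ y ub n → ⊑-trans (C n) (≤-truncate-at n c) (ub n n)

  seq-truncate-bottom : ∀ {n j} c → n ≤ j → IsBottom _⊑D_ (seq (truncate n c) j)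
  seq-truncate-bottom {j = j} c z≤n = IsBottom-head (tailⁿ j ⊥C) (IsBottom-tailⁿ j ⊥C ⊥C-least)
  seq-truncate-bottom {suc n} {suc j} c (s≤s n≤j) =
    subst (IsBottom _⊑D_) (sym (seq-suc j (truncate (suc n) c))) (seq-truncate-bottom (tail c) n≤j)

  Compact⇒eventually-bottom : ∀ c → Compact _⊑C_ c
                            → Σ ℕ λ n → ∀ j → n ≤ j → IsBottom _⊑D_ (seq c j)
  Compact⇒eventually-bottom c c-cpt =
    let (n , c⊑truncate) = c-cpt (λ n → truncate n c) (truncate-directed c) c (truncate-lub c) (⊑C-refl {c})
    in n , λ j n≤j d → ⊑D-trans {seq c j} {seq (truncate n c) j} {d}
                         (seq-mono j c (truncate n c) c⊑truncate) (seq-truncate-bottom c n≤j d)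

  Compact-from-seq : ∀ n c → (∀ j → Compact _⊑D_ (seq c j))
                   → (∀ j → n ≤ j → IsBottom _⊑D_ (seq c j)) → Compact _⊑C_ c
  Compact-from-seq zero c _ bot =
    IsBottom⇒Compact {_⊑_ = _⊑C_} {c} λ y → ⊑C-from-seq c y λ j → bot j z≤n (seq y j)
  Compact-from-seq (suc n) c cpt bot = Equivalence.from (Compact-C⇔ c)
    ( cpt 0
    , Compact-from-seq n (tail c)
        (λ j → subst (Compact _⊑D_) (seq-suc j c) (cpt (suc j)))
        (λ j n≤j → subst (IsBottom _⊑D_) (seq-suc j c) (bot (suc j) (s≤s n≤j))))

proposition3p2 : (R : Lattice) → OmegaAlgebraic R → (c : Tower.Cinf R)
    → Compact (Tower._⊑C_ R) c
    ⇔ ((∀ i → Compact (Tower._⊑D_ R) (Tower.seq R c i))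
    × Σ ℕ (λ i → ∀ j → i ≤ j → IsBottom (Tower._⊑D_ R) (Tower.seq R c j)))
proposition3p2 R _ c = mk⇔ {A = Compact (Tower._⊑C_ R) c}
  (λ c-cpt → Compact-seq c c-cpt , Compact⇒eventually-bottom c c-cpt)
  (λ (cpt , n , bot) → Compact-from-seq n c cpt bot)
  where open TowerProperties R
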